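{- Let $1\le k<n$ and let $b=b_{k+1}\ldots b_n$ be an admissible suffix in $S_n$. Let $s$ be the last sequence (with respect to $\prec_c$) among the sequences of $S_n$ having suffix $b$, and let $P=\sum_{i=k+1}^n b_i+(n-k)$. Then: (i) if $b_{k+1}=k$ or $P$ is odd, $s=0\,1\,2\ldots(k-2)(k-1)\,b$; (ii) if $b_{k+1}<k$, $P$ is even, and either $b_{k+1}=0$ or $b_{k+1}$ is odd, $s=0\,1\,2\ldots(k-2)\,(\max\{0,b_{k+1}-1\})\,b$; (iii) if $b_{k+1}<k$, $P$ is even, and $b_{k+1}>0$ is even, $s=0\,1\,2\ldots(k-3)\,(b_{k+1}-2)(b_{k+1}-1)\,b$. The same holds for the first sequence (with respect to $\prec_c$) among the sequences of $S_n$ having suffix $b$, with "odd" and "even" interchanged for the parity of $P$.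
   Context: $S_n$ is the set of sequences $s_1\ldots s_n$ of non-negative integers with $s_1=0$ and $0\le s_{k+1}\le s_k+1$ for $1\le k<n$. A word $b=b_{k+1}\ldots b_n$ is an admissible suffix in $S_n$ if some sequence of $S_n$ ends with $b$. Co-Reflected Gray Code order: $s\prec_c t$ if, with $k$ the rightmost position where $s$ and $t$ differ, either $\sum_{i=k+1}^n s_i+(n-k)$ is even and $s_k>t_k$, or it is odd and $s_k<t_k$. -}

module Defs where

open import Data.Nat using (ℕ; zero; suc; _+_; _∸_; _≤_; _<_; _%_)
open import Data.List using (List; []; _∷_; _++_; length)
open import Data.Nat.ListAction using (sum)
open import Data.Product using (Σ; ∃; _×_; _,_)
open import Data.Sum using (_⊎_)
open import Data.Unit using (⊤)
open import Relation.Binary.PropositionalEquality using (_≡_)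

Even : ℕ → Set
Even m = m % 2 ≡ 0

Odd : ℕ → Set
Odd m = m % 2 ≡ 1

FirstZero : List ℕ → Set
FirstZero []      = ⊤
FirstZero (x ∷ _) = x ≡ 0

-- 0 ≤ s_{k+1} ≤ s_k + 1 for consecutive entries (non-negativity is built into ℕ)
Steps : List ℕ → Set
Steps []            = ⊤
Steps (x ∷ [])      = ⊤
Steps (x ∷ y ∷ r)   = (y ≤ suc x) × Steps (y ∷ r)

InS : ℕ → List ℕ → Set
InS n s = (length s ≡ n) × FirstZero s × Steps s

HasSuffix : List ℕ → List ℕ → Set
HasSuffix b s = ∃ λ p → s ≡ p ++ b

Admissible : ℕ → List ℕ → Set
Admissible n b = ∃ λ s → InS n s × HasSuffix b s

-- Co-Reflected Gray Code order.  s = p ++ x ∷ c, t = q ++ y ∷ c with |p| = |q| and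
-- x ≠ y (forced by the strict comparisons), so position k = |p|+1 is the rightmost
-- position where s and t differ, c = s_{k+1} … s_n and n - k = length c.
_≺c_ : List ℕ → List ℕ → Set
s ≺c t = Σ (List ℕ) λ p → Σ (List ℕ) λ q → Σ ℕ λ x → Σ ℕ λ y → Σ (List ℕ) λ c →
  (s ≡ p ++ x ∷ c) × (t ≡ q ++ y ∷ c) × (length p ≡ length q) ×
  ((Even (sum c + length c) × y < x) ⊎ (Odd (sum c + length c) × x < y))

InSWithSuffix : ℕ → List ℕ → List ℕ → Set
InSWithSuffix n b s = InS n s × HasSuffix b s

IsLast : ℕ → List ℕ → List ℕ → Set
IsLast n b s = InSWithSuffix n b s × (∀ t → InSWithSuffix n b t → (t ≡ s) ⊎ (t ≺c s))

IsFirst : ℕ → List ℕ → List ℕ → Set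
IsFirst n b s = InSWithSuffix n b s × (∀ t → InSWithSuffix n b t → (t ≡ s) ⊎ (s ≺c t))

TheLastIs : ℕ → List ℕ → List ℕ → Set
TheLastIs n b s₀ = IsLast n b s₀ × (∀ s → IsLast n b s → s ≡ s₀)

TheFirstIs : ℕ → List ℕ → List ℕ → Set
TheFirstIs n b s₀ = IsFirst n b s₀ × (∀ s → IsFirst n b s → s ≡ s₀)

-- Scanning a sequence of S_n from right to left, the entry in front of a fixed suffix c = c₁ … can be
-- any x with c₁ - 1 ≤ x ≤ m, where m + 1 is its position.  Two sequences with suffix c whose entries
-- there differ are compared by ≺c through these entries alone, in a direction fixed by the parity
-- of P(c) = sum c + length c.
-- Hence the ≺c-last (≺c-first) sequence with suffix b is built greedily: each entry takes the
-- extreme admissible value in the preferred direction.  Once an entry equals its maximum m, every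
-- entry in front of it is forced to be maximal, giving 0 1 … (m-1); before that happens the greedy
-- choice takes the low value c₁ - 1 at most twice, which yields the three closed forms.
module Submission where

open import Defs
open import Data.Nat using (ℕ; zero; suc; _+_; _∸_; _≤_; _<_; z≤n; s≤s; parity)
open import Data.Nat.Properties
  using (≤-refl; ≤-trans; +-monoʳ-≤; <⇒≤; ≤∧≢⇒<; <-irrefl; <-asym; ∸-monoˡ-≤; m≤n+m∸n; n≤0⇒n≡0;
         +-suc; +-assoc; +-comm; +-cancelʳ-≡; m+[n∸m]≡n; suc-injective; _≟_; module ≤-Reasoning)
open import Data.Parity.Base as ℙ using (Parity; 0ℙ; 1ℙ; _⁻¹)
open import Data.Parity.Properties using (⁻¹-selfInverse; +-homo-+)
open import Data.List using (List; []; _∷_; _++_; [_]; _∷ʳ_; length; upTo; reverse)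
open import Data.List.Base using (initLast; _∷ʳ′_)
open import Data.List.Properties
  using (++-assoc; length-++; ∷-injectiveˡ; ∷-injectiveʳ; reverse-++; unfold-reverse;
         reverse-injective; upTo-∷ʳ)
open import Data.Nat.ListAction using (sum)
open import Data.Product using (∃; _×_; _,_; proj₁; proj₂)
import Data.Product as Product
open import Data.Sum using (_⊎_; inj₁; inj₂)
import Data.Sum as Sum
open import Data.Unit using (tt)
open import Data.Empty using (⊥-elim)
open import Function using (_∘_)
open import Relation.Nullary using (¬_; yes; no)
open import Relation.Binary.PropositionalEquality
  using (_≡_; _≢_; refl; sym; trans; cong; cong₂; subst; module ≡-Reasoning)

even⇒parity≡0ℙ : ∀ m → Even m → parity m ≡ 0ℙ
even⇒parity≡0ℙ zero          _ = refl
even⇒parity≡0ℙ (suc zero)    ()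
even⇒parity≡0ℙ (suc (suc m)) e = even⇒parity≡0ℙ m e

odd⇒parity≡1ℙ : ∀ m → Odd m → parity m ≡ 1ℙ
odd⇒parity≡1ℙ zero          ()
odd⇒parity≡1ℙ (suc zero)    _ = refl
odd⇒parity≡1ℙ (suc (suc m)) o = odd⇒parity≡1ℙ m o

parity≡0ℙ⇒even : ∀ m → parity m ≡ 0ℙ → Even m
parity≡0ℙ⇒even zero          _ = refl
parity≡0ℙ⇒even (suc zero)    ()
parity≡0ℙ⇒even (suc (suc m)) e = parity≡0ℙ⇒even m e

parity≡1ℙ⇒odd : ∀ m → parity m ≡ 1ℙ → Odd m
parity≡1ℙ⇒odd zero          ()
parity≡1ℙ⇒odd (suc zero)    _ = refl
parity≡1ℙ⇒odd (suc (suc m)) o = parity≡1ℙ⇒odd m o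

¬even∧odd : ∀ {m} → Even m → ¬ Odd m
¬even∧odd e o with () ← trans (sym e) o

parity-suc : ∀ m → parity (suc m) ≡ parity m ⁻¹
parity-suc = +-homo-+ 1

parity-pred≡0ℙ : ∀ {m} → (m ≡ 0) ⊎ Odd m → parity (m ∸ 1) ≡ 0ℙ
parity-pred≡0ℙ {zero}  _        = refl
parity-pred≡0ℙ {suc m} (inj₂ o) =
  sym (⁻¹-selfInverse (trans (sym (parity-suc m)) (odd⇒parity≡1ℙ (suc m) o)))

+-⁻¹-exchange : ∀ p q r → p ℙ.+ (q ℙ.+ r) ⁻¹ ≡ (q ℙ.+ (p ℙ.+ r)) ⁻¹
+-⁻¹-exchange 0ℙ q  r = refl
+-⁻¹-exchange 1ℙ 0ℙ r = refl
+-⁻¹-exchange 1ℙ 1ℙ r = refl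

weight : List ℕ → ℕ
weight c = sum c + length c

parity-weight-∷ : ∀ x c → parity (weight (x ∷ c)) ≡ (parity x ℙ.+ parity (weight c)) ⁻¹
parity-weight-∷ x c = begin
  parity (x + sum c + suc (length c))   ≡⟨ cong parity (+-suc (x + sum c) (length c)) ⟩
  parity (suc (x + sum c + length c))   ≡⟨ cong (parity ∘ suc) (+-assoc x (sum c) (length c)) ⟩
  parity (suc (x + weight c))           ≡⟨ parity-suc (x + weight c) ⟩
  parity (x + weight c) ⁻¹              ≡⟨ cong _⁻¹ (+-homo-+ x (weight c)) ⟩
  (parity x ℙ.+ parity (weight c)) ⁻¹   ∎
  where open ≡-Reasoning

-- The condition in s ≺c t, where x and y are the entries of s and t in front of their common suffix c.
Order : List ℕ → ℕ → ℕ → Set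
Order c x y = (Even (weight c) × y < x) ⊎ (Odd (weight c) × x < y)

Order⇒≢ : ∀ {c x y} → Order c x y → x ≢ y
Order⇒≢ (inj₁ (_ , y<x)) refl = <-irrefl refl y<x
Order⇒≢ (inj₂ (_ , x<y)) refl = <-irrefl refl x<y

Order-asym : ∀ {c x y} → Order c x y → ¬ Order c y x
Order-asym     (inj₁ (_ , y<x)) (inj₁ (_ , x<y)) = <-asym y<x x<y
Order-asym {c} (inj₁ (e , _))   (inj₂ (o , _))   = ¬even∧odd {weight c} e o
Order-asym {c} (inj₂ (o , _))   (inj₁ (e , _))   = ¬even∧odd {weight c} e o
Order-asym     (inj₂ (_ , x<y)) (inj₂ (_ , y<x)) = <-asym y<x x<y

first-difference-unique : ∀ {A : Set} (u u′ : List A) {x y x′ y′ : A} {v w v′ w′ : List A} →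
  u ++ x ∷ v ≡ u′ ++ x′ ∷ v′ → u ++ y ∷ w ≡ u′ ++ y′ ∷ w′ → x ≢ y → x′ ≢ y′ →
  u ≡ u′ × x ≡ x′ × y ≡ y′
first-difference-unique []      []       e₁ e₂ _ _ = refl , ∷-injectiveˡ e₁ , ∷-injectiveˡ e₂
first-difference-unique []      (_ ∷ _)  e₁ e₂ x≢y _ =
  ⊥-elim (x≢y (trans (∷-injectiveˡ e₁) (sym (∷-injectiveˡ e₂))))
first-difference-unique (_ ∷ _) []       e₁ e₂ _ x′≢y′ =
  ⊥-elim (x′≢y′ (trans (sym (∷-injectiveˡ e₁)) (∷-injectiveˡ e₂)))
first-difference-unique (_ ∷ u) (_ ∷ u′) e₁ e₂ x≢y x′≢y′
  with first-difference-unique u u′ (∷-injectiveʳ e₁) (∷-injectiveʳ e₂) x≢y x′≢y′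
... | u≡u′ , x≡x′ , y≡y′ = cong₂ _∷_ (∷-injectiveˡ e₁) u≡u′ , x≡x′ , y≡y′

reverse-++-∷ : ∀ {A : Set} (p : List A) x c → reverse (p ++ x ∷ c) ≡ reverse c ++ x ∷ reverse p
reverse-++-∷ p x c = begin
  reverse (p ++ x ∷ c)           ≡⟨ reverse-++ p (x ∷ c) ⟩
  reverse (x ∷ c) ++ reverse p   ≡⟨ cong (_++ reverse p) (unfold-reverse x c) ⟩
  (reverse c ∷ʳ x) ++ reverse p  ≡⟨ ++-assoc (reverse c) [ x ] (reverse p) ⟩
  reverse c ++ x ∷ reverse p     ∎
  where open ≡-Reasoning

reverse-++-∷-≡ : ∀ {A : Set} p (x : A) c p′ x′ c′ → p ++ x ∷ c ≡ p′ ++ x′ ∷ c′ →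
  reverse c ++ x ∷ reverse p ≡ reverse c′ ++ x′ ∷ reverse p′
reverse-++-∷-≡ p x c p′ x′ c′ e =
  trans (sym (reverse-++-∷ p x c)) (trans (cong reverse e) (reverse-++-∷ p′ x′ c′))

last-difference-unique : ∀ {A : Set} {p q p′ q′ c c′ : List A} {x y x′ y′ : A} →
  p ++ x ∷ c ≡ p′ ++ x′ ∷ c′ → q ++ y ∷ c ≡ q′ ++ y′ ∷ c′ → x ≢ y → x′ ≢ y′ →
  c ≡ c′ × x ≡ x′ × y ≡ y′
last-difference-unique {p = p} {q} {p′} {q′} {c} {c′} {x} {y} {x′} {y′} e₁ e₂ x≢y x′≢y′
  with first-difference-unique (reverse c) (reverse c′)
         (reverse-++-∷-≡ p x c p′ x′ c′ e₁) (reverse-++-∷-≡ q y c q′ y′ c′ e₂) x≢y x′≢y′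
... | rc≡rc′ , x≡x′ , y≡y′ = reverse-injective rc≡rc′ , x≡x′ , y≡y′

≺c-asym : ∀ {s t} → s ≺c t → ¬ (t ≺c s)
≺c-asym (_ , _ , _ , _ , c , refl , refl , _ , o) (_ , _ , _ , _ , c′ , e₁ , e₂ , _ , o′)
  with last-difference-unique e₂ e₁ (Order⇒≢ {c} o) (Order⇒≢ {c′} o′ ∘ sym)
... | refl , refl , refl = Order-asym {c} o o′

Steps-tail : ∀ {a} r → Steps (a ∷ r) → Steps r
Steps-tail []      _        = tt
Steps-tail (_ ∷ _) (_ , st) = st

Steps-++⁻ : ∀ p {c} → Steps (p ++ c) → Steps c
Steps-++⁻ []      st = st
Steps-++⁻ (_ ∷ p) st = Steps-++⁻ p (Steps-tail (p ++ _) st)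

Steps⇒≤-distance : ∀ a q {y r} → Steps (a ∷ q ++ y ∷ r) → y ≤ length q + suc a
Steps⇒≤-distance a []      (y≤1+a , _) = y≤1+a
Steps⇒≤-distance a (c ∷ q) {y} (c≤1+a , st) = begin
  y                       ≤⟨ Steps⇒≤-distance c q st ⟩
  length q + suc c        ≤⟨ +-monoʳ-≤ (length q) (s≤s c≤1+a) ⟩
  length q + suc (suc a)  ≡⟨ +-suc (length q) (suc a) ⟩
  suc (length q + suc a)  ∎
  where open ≤-Reasoning

entry-≤-index : ∀ q {y r} → FirstZero (q ++ y ∷ r) → Steps (q ++ y ∷ r) → y ≤ length q
entry-≤-index []      refl _  = z≤n
entry-≤-index (_ ∷ q) {y} refl st = subst (y ≤_) (+-comm (length q) 1) (Steps⇒≤-distance 0 q st)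

Completes : ℕ → List ℕ → List ℕ → Set
Completes m c t = FirstZero t × Steps t × ∃ λ p → t ≡ p ++ c × length p ≡ m

completes-steps : ∀ {m c t} → Completes m c t → Steps c
completes-steps (_ , st , p , refl , _) = Steps-++⁻ p st

completes-head-≤ : ∀ {m y r t} → Completes m (y ∷ r) t → y ≤ m
completes-head-≤ (fz , st , p , refl , refl) = entry-≤-index p fz st

completes-∷ : ∀ {m x c t} → Completes m (x ∷ c) t → Completes (suc m) c t
completes-∷ {x = x} {c} (fz , st , p , refl , refl) =
  fz , st , p ∷ʳ x , sym (++-assoc p [ x ] c) , trans (length-++ p) (+-comm (length p) 1)

completes-suc⁻ : ∀ {m c t} → Completes (suc m) c t → ∃ λ y → Completes m (y ∷ c) t
completes-suc⁻ (fz , st , p , e , l) with initLast p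
... | []       with () ← l
... | p ∷ʳ′ y = y , fz , st , p , trans e (++-assoc p [ y ] _) ,
                suc-injective (trans (+-comm 1 (length p)) (trans (sym (length-++ p)) l))

module _ {n k : ℕ} {b : List ℕ} (k≤n : k ≤ n) (|b|≡n∸k : length b ≡ n ∸ k) where

  completes⇒inS : ∀ {t} → Completes k b t → InSWithSuffix n b t
  completes⇒inS (fz , st , p , refl , refl) = (|t|≡n , fz , st) , p , refl
    where
    |t|≡n : length (p ++ b) ≡ n
    |t|≡n = trans (length-++ p) (trans (cong (length p +_) |b|≡n∸k) (m+[n∸m]≡n k≤n))

  inS⇒completes : ∀ {t} → InSWithSuffix n b t → Completes k b t
  inS⇒completes ((|t|≡n , fz , st) , p , refl) =
    fz , st , p , refl , +-cancelʳ-≡ (n ∸ k) (length p) k |p|+|b|≡k+|b|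
    where
    |p|+|b|≡k+|b| : length p + (n ∸ k) ≡ k + (n ∸ k)
    |p|+|b|≡k+|b| = trans (cong (length p +_) (sym |b|≡n∸k))
                      (trans (sym (length-++ p)) (trans |t|≡n (sym (m+[n∸m]≡n k≤n))))

choose : Parity → ℕ → ℕ → ℕ
choose 0ℙ lo hi = lo
choose 1ℙ lo hi = hi

choose-same : ∀ τ a → choose τ a a ≡ a
choose-same 0ℙ a = refl
choose-same 1ℙ a = refl

choose-∈ : ∀ τ {lo hi} → lo ≤ hi → lo ≤ choose τ lo hi × choose τ lo hi ≤ hi
choose-∈ 0ℙ lo≤hi = ≤-refl , lo≤hi
choose-∈ 1ℙ lo≤hi = lo≤hi , ≤-refl

choose-extreme : ∀ τ {lo hi y} → lo ≤ y → y ≤ hi → y ≢ choose τ lo hi →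
  (τ ≡ 0ℙ × choose τ lo hi < y) ⊎ (τ ≡ 1ℙ × y < choose τ lo hi)
choose-extreme 0ℙ lo≤y _    y≢lo = inj₁ (refl , ≤∧≢⇒< lo≤y (y≢lo ∘ sym))
choose-extreme 1ℙ _    y≤hi y≢hi = inj₂ (refl , ≤∧≢⇒< y≤hi y≢hi)

-- π = 0ℙ asks for the ≺c-last sequence, π = 1ℙ for the ≺c-first one; with this encoding the
-- greedy entry in front of c is the low one exactly when turn π c ≡ 0ℙ.
Outranks : Parity → List ℕ → List ℕ → Set
Outranks 0ℙ s t = t ≺c s
Outranks 1ℙ s t = s ≺c t

turn : Parity → List ℕ → Parity
turn π c = π ℙ.+ parity (weight c)

turn-∷ : ∀ π x c → turn π (x ∷ c) ≡ (parity x ℙ.+ turn π c) ⁻¹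
turn-∷ π x c = trans (cong (π ℙ.+_) (parity-weight-∷ x c)) (+-⁻¹-exchange π (parity x) (parity (weight c)))

greedy : Parity → ℕ → ℕ → List ℕ → List ℕ
greedy π zero    c₁ cs = c₁ ∷ cs
greedy π (suc m) c₁ cs = greedy π m (choose (turn π (c₁ ∷ cs)) (c₁ ∸ 1) m) (c₁ ∷ cs)

outranks-at : ∀ π {m x y c s t} → Completes m (x ∷ c) s → Completes m (y ∷ c) t →
  (turn π c ≡ 0ℙ × x < y) ⊎ (turn π c ≡ 1ℙ × y < x) → Outranks π s t
outranks-at 0ℙ {c = c} (_ , _ , p , refl , refl) (_ , _ , q , refl , |q|≡|p|) h =
  q , p , _ , _ , _ , refl , refl , |q|≡|p| ,
  Sum.map (Product.map₁ (parity≡0ℙ⇒even (weight c))) (Product.map₁ (parity≡1ℙ⇒odd (weight c))) h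
outranks-at 1ℙ {c = c} (_ , _ , p , refl , refl) (_ , _ , q , refl , |q|≡|p|) h =
  p , q , _ , _ , _ , refl , refl , sym |q|≡|p| ,
  Sum.swap (Sum.map (Product.map₁ odd) (Product.map₁ even) h)
  where
  odd : parity (weight c) ⁻¹ ≡ 0ℙ → Odd (weight c)
  odd e = parity≡1ℙ⇒odd (weight c) (sym (⁻¹-selfInverse e))
  even : parity (weight c) ⁻¹ ≡ 1ℙ → Even (weight c)
  even e = parity≡0ℙ⇒even (weight c) (sym (⁻¹-selfInverse e))

BestCompletion : Parity → ℕ → List ℕ → List ℕ → Set
BestCompletion π m c g = Completes m c g × (∀ t → Completes m c t → t ≡ g ⊎ Outranks π g t)

greedy-best : ∀ π m c₁ cs → c₁ ≤ m → Steps (c₁ ∷ cs) → BestCompletion π m (c₁ ∷ cs) (greedy π m c₁ cs)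
greedy-best π zero c₁ cs c₁≤0 st = (first-zero , st , [] , refl , refl) , only
  where
  first-zero : FirstZero (c₁ ∷ cs)
  first-zero = n≤0⇒n≡0 c₁≤0
  only : ∀ t → Completes zero (c₁ ∷ cs) t → t ≡ c₁ ∷ cs ⊎ Outranks π (c₁ ∷ cs) t
  only t (_ , _ , [] , refl , refl) = inj₁ refl
greedy-best π (suc m) c₁ cs c₁≤1+m st = completes-∷ g-completes , best
  where
  c : List ℕ
  c = c₁ ∷ cs
  τ : Parity
  τ = turn π c
  x : ℕ
  x = choose τ (c₁ ∸ 1) m
  x-bounds : c₁ ∸ 1 ≤ x × x ≤ m
  x-bounds = choose-∈ τ (∸-monoˡ-≤ 1 c₁≤1+m)
  c₁≤1+x : c₁ ≤ suc x
  c₁≤1+x = ≤-trans (m≤n+m∸n c₁ 1) (s≤s (proj₁ x-bounds))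
  IH : BestCompletion π m (x ∷ c) (greedy π m x c)
  IH = greedy-best π m x c (proj₂ x-bounds) (c₁≤1+x , st)
  g-completes : Completes m (x ∷ c) (greedy π m x c)
  g-completes = proj₁ IH
  best : ∀ t → Completes (suc m) c t → t ≡ greedy π m x c ⊎ Outranks π (greedy π m x c) t
  best t t-completes with completes-suc⁻ t-completes
  ... | y , t-completes′ with y ≟ x
  ...   | yes refl = proj₂ IH t t-completes′
  ...   | no  y≢x  =
    inj₂ (outranks-at π g-completes t-completes′ (choose-extreme τ lo≤y (completes-head-≤ t-completes′) y≢x))
    where
    lo≤y : c₁ ∸ 1 ≤ y
    lo≤y = ∸-monoˡ-≤ 1 (proj₁ (completes-steps t-completes′))

outranks-asym : ∀ π {s t} → Outranks π s t → ¬ Outranks π t s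
outranks-asym 0ℙ = ≺c-asym
outranks-asym 1ℙ = ≺c-asym

outranker-unique : ∀ π {P : List ℕ → Set} {s s′} → P s → P s′ →
  (∀ t → P t → t ≡ s ⊎ Outranks π s t) → (∀ t → P t → t ≡ s′ ⊎ Outranks π s′ t) → s′ ≡ s
outranker-unique π Ps Ps′ best best′ with best _ Ps′ | best′ _ Ps
... | inj₁ s′≡s | _          = s′≡s
... | inj₂ _    | inj₁ s≡s′  = sym s≡s′
... | inj₂ o    | inj₂ o′    = ⊥-elim (outranks-asym π o o′)

TheExtremalIs : Parity → ℕ → List ℕ → List ℕ → Set
TheExtremalIs 0ℙ = TheLastIs
TheExtremalIs 1ℙ = TheFirstIs

outranker-is-extremal : ∀ π {n b s₀} → InSWithSuffix n b s₀ →
  (∀ t → InSWithSuffix n b t → t ≡ s₀ ⊎ Outranks π s₀ t) → TheExtremalIs π n b s₀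
outranker-is-extremal 0ℙ s₀-in best =
  (s₀-in , best) , λ s (s-in , s-best) → outranker-unique 0ℙ s₀-in s-in best s-best
outranker-is-extremal 1ℙ s₀-in best =
  (s₀-in , best) , λ s (s-in , s-best) → outranker-unique 1ℙ s₀-in s-in best s-best

greedy-is-extremal : ∀ π {n k b₁ bs} → k ≤ n → length (b₁ ∷ bs) ≡ n ∸ k → Admissible n (b₁ ∷ bs) →
  TheExtremalIs π n (b₁ ∷ bs) (greedy π k b₁ bs)
greedy-is-extremal π {k = k} {b₁} {bs} k≤n |b|≡n∸k (s , s-in) =
  outranker-is-extremal π (completes⇒inS k≤n |b|≡n∸k (proj₁ best))
    (λ t t-in → proj₂ best t (inS⇒completes k≤n |b|≡n∸k t-in))
  where
  s-completes : Completes k (b₁ ∷ bs) s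
  s-completes = inS⇒completes k≤n |b|≡n∸k s-in
  best : BestCompletion π k (b₁ ∷ bs) (greedy π k b₁ bs)
  best = greedy-best π k b₁ bs (completes-head-≤ s-completes) (completes-steps s-completes)

upTo-suc-++ : ∀ m r → upTo (suc m) ++ r ≡ upTo m ++ m ∷ r
upTo-suc-++ m r = trans (cong (_++ r) (sym (upTo-∷ʳ m))) (++-assoc (upTo m) [ m ] r)

greedy-top : ∀ π m cs → greedy π m m cs ≡ upTo m ++ m ∷ cs
greedy-top π zero    cs = refl
greedy-top π (suc m) cs = begin
  greedy π m (choose (turn π (suc m ∷ cs)) m m) (suc m ∷ cs)  ≡⟨ cong (λ x → greedy π m x _) (choose-same _ m) ⟩
  greedy π m m (suc m ∷ cs)                                   ≡⟨ greedy-top π m (suc m ∷ cs) ⟩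
  upTo m ++ m ∷ suc m ∷ cs                                    ≡⟨ upTo-suc-++ m (suc m ∷ cs) ⟨
  upTo (suc m) ++ suc m ∷ cs                                  ∎
  where open ≡-Reasoning

greedy-high : ∀ π k c₁ cs → (c₁ ≡ k) ⊎ (turn π (c₁ ∷ cs) ≡ 1ℙ) → greedy π k c₁ cs ≡ upTo k ++ c₁ ∷ cs
greedy-high π zero    c₁ cs _ = refl
greedy-high π (suc m) c₁ cs h = begin
  greedy π m (choose (turn π (c₁ ∷ cs)) (c₁ ∸ 1) m) (c₁ ∷ cs) ≡⟨ cong (λ x → greedy π m x _) (chooses-high h) ⟩
  greedy π m m (c₁ ∷ cs)                                      ≡⟨ greedy-top π m (c₁ ∷ cs) ⟩
  upTo m ++ m ∷ c₁ ∷ cs                                       ≡⟨ upTo-suc-++ m (c₁ ∷ cs) ⟨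
  upTo (suc m) ++ c₁ ∷ cs                                     ∎
  where
  open ≡-Reasoning
  chooses-high : (c₁ ≡ suc m) ⊎ (turn π (c₁ ∷ cs) ≡ 1ℙ) → choose (turn π (c₁ ∷ cs)) (c₁ ∸ 1) m ≡ m
  chooses-high (inj₁ refl) = choose-same _ m
  chooses-high (inj₂ τ≡1ℙ) = cong (λ τ → choose τ (c₁ ∸ 1) m) τ≡1ℙ

-- A low choice of even value c₁ - 1 is followed only by high choices, since it flips the turn.
greedy-low : ∀ π k c₁ cs → 1 ≤ k → turn π (c₁ ∷ cs) ≡ 0ℙ → parity (c₁ ∸ 1) ≡ 0ℙ →
  greedy π k c₁ cs ≡ upTo (k ∸ 1) ++ (c₁ ∸ 1) ∷ c₁ ∷ cs
greedy-low π (suc m) c₁ cs _ τ≡0ℙ p≡0ℙ = begin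
  greedy π m (choose (turn π (c₁ ∷ cs)) (c₁ ∸ 1) m) (c₁ ∷ cs)
    ≡⟨ cong (λ τ → greedy π m (choose τ (c₁ ∸ 1) m) _) τ≡0ℙ ⟩
  greedy π m (c₁ ∸ 1) (c₁ ∷ cs)
    ≡⟨ greedy-high π m (c₁ ∸ 1) (c₁ ∷ cs) (inj₂ next-high) ⟩
  upTo m ++ (c₁ ∸ 1) ∷ c₁ ∷ cs
    ∎
  where
  open ≡-Reasoning
  next-high : turn π ((c₁ ∸ 1) ∷ c₁ ∷ cs) ≡ 1ℙ
  next-high = trans (turn-∷ π (c₁ ∸ 1) (c₁ ∷ cs)) (cong₂ (λ p τ → (p ℙ.+ τ) ⁻¹) p≡0ℙ τ≡0ℙ)

-- An even c₁ ≥ 2 and a low choice give the odd entry c₁ - 1, which leaves the turn unchanged.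
greedy-low-twice : ∀ π k c₁ cs → c₁ < k → 0 < c₁ → parity c₁ ≡ 0ℙ → turn π (c₁ ∷ cs) ≡ 0ℙ →
  greedy π k c₁ cs ≡ upTo (k ∸ 2) ++ (c₁ ∸ 2) ∷ (c₁ ∸ 1) ∷ c₁ ∷ cs
greedy-low-twice π (suc (suc m)) (suc (suc r)) cs (s≤s (s≤s _)) _ pr≡0ℙ τ≡0ℙ = begin
  greedy π (suc m) (choose (turn π c) (suc r) (suc m)) c
    ≡⟨ cong (λ τ → greedy π (suc m) (choose τ (suc r) (suc m)) c) τ≡0ℙ ⟩
  greedy π (suc m) (suc r) c
    ≡⟨ greedy-low π (suc m) (suc r) c (s≤s z≤n) next-low pr≡0ℙ ⟩
  upTo m ++ r ∷ suc r ∷ c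
    ∎
  where
  open ≡-Reasoning
  c : List ℕ
  c = suc (suc r) ∷ cs
  next-low : turn π (suc r ∷ c) ≡ 0ℙ
  next-low = trans (turn-∷ π (suc r) c)
                   (cong₂ (λ p τ → (p ℙ.+ τ) ⁻¹) (trans (parity-suc r) (cong _⁻¹ pr≡0ℙ)) τ≡0ℙ)
greedy-low-twice π _ (suc zero) _ _ _ () _
greedy-low-twice π (suc zero) (suc (suc _)) _ (s≤s ()) _ _ _

proposition14 : (n k : ℕ) → 1 ≤ k → k < n → (b₁ : ℕ) → (bs : List ℕ) →
    length (b₁ ∷ bs) ≡ n ∸ k → Admissible n (b₁ ∷ bs) →
    (((b₁ ≡ k) ⊎ Odd (sum (b₁ ∷ bs) + (n ∸ k))) →
        TheLastIs n (b₁ ∷ bs) (upTo k ++ b₁ ∷ bs))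
    × ((b₁ < k) → Even (sum (b₁ ∷ bs) + (n ∸ k)) → ((b₁ ≡ 0) ⊎ Odd b₁) →
        TheLastIs n (b₁ ∷ bs) (upTo (k ∸ 1) ++ (b₁ ∸ 1) ∷ b₁ ∷ bs))
    × ((b₁ < k) → Even (sum (b₁ ∷ bs) + (n ∸ k)) → (0 < b₁) → Even b₁ →
        TheLastIs n (b₁ ∷ bs) (upTo (k ∸ 2) ++ (b₁ ∸ 2) ∷ (b₁ ∸ 1) ∷ b₁ ∷ bs))
    × (((b₁ ≡ k) ⊎ Even (sum (b₁ ∷ bs) + (n ∸ k))) →
        TheFirstIs n (b₁ ∷ bs) (upTo k ++ b₁ ∷ bs))
    × ((b₁ < k) → Odd (sum (b₁ ∷ bs) + (n ∸ k)) → ((b₁ ≡ 0) ⊎ Odd b₁) →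
        TheFirstIs n (b₁ ∷ bs) (upTo (k ∸ 1) ++ (b₁ ∸ 1) ∷ b₁ ∷ bs))
    × ((b₁ < k) → Odd (sum (b₁ ∷ bs) + (n ∸ k)) → (0 < b₁) → Even b₁ →
        TheFirstIs n (b₁ ∷ bs) (upTo (k ∸ 2) ++ (b₁ ∸ 2) ∷ (b₁ ∸ 1) ∷ b₁ ∷ bs))
proposition14 n k 1≤k k<n b₁ bs |b|≡n∸k adm =
  (λ h → last (greedy-high 0ℙ k b₁ bs (Sum.map₂ odd-P h))) ,
  (λ _ e h → last (greedy-low 0ℙ k b₁ bs 1≤k (even-P e) (parity-pred≡0ℙ h))) ,
  (λ lt e pos eb → last (greedy-low-twice 0ℙ k b₁ bs lt pos (even⇒parity≡0ℙ b₁ eb) (even-P e))) ,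
  (λ h → first (greedy-high 1ℙ k b₁ bs (Sum.map₂ (cong _⁻¹ ∘ even-P) h))) ,
  (λ _ o h → first (greedy-low 1ℙ k b₁ bs 1≤k (cong _⁻¹ (odd-P o)) (parity-pred≡0ℙ h))) ,
  (λ lt o pos eb → first (greedy-low-twice 1ℙ k b₁ bs lt pos (even⇒parity≡0ℙ b₁ eb) (cong _⁻¹ (odd-P o))))
  where
  b : List ℕ
  b = b₁ ∷ bs
  P≡weight : sum b + (n ∸ k) ≡ weight b
  P≡weight = cong (sum b +_) (sym |b|≡n∸k)
  even-P : Even (sum b + (n ∸ k)) → parity (weight b) ≡ 0ℙ
  even-P = even⇒parity≡0ℙ (weight b) ∘ subst Even P≡weight
  odd-P : Odd (sum b + (n ∸ k)) → parity (weight b) ≡ 1ℙ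
  odd-P = odd⇒parity≡1ℙ (weight b) ∘ subst Odd P≡weight
  last : ∀ {s} → greedy 0ℙ k b₁ bs ≡ s → TheLastIs n b s
  last g≡s = subst (TheLastIs n b) g≡s (greedy-is-extremal 0ℙ (<⇒≤ k<n) |b|≡n∸k adm)
  first : ∀ {s} → greedy 1ℙ k b₁ bs ≡ s → TheFirstIs n b s
  first g≡s = subst (TheFirstIs n b) g≡s (greedy-is-extremal 1ℙ (<⇒≤ k<n) |b|≡n∸k adm)
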